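{- Let $r,c\ge 2$ and $v$ be positive integers with $v \ge rc - c/2$. Then there exists an $(r\times c, v)$-near triple array.
   Context: An $r\times c$ row-column design on $v$ symbols is an $r\times c$ array each of whose cells is filled with one of $v$ symbols (symbols may be unused). It is binary if no symbol occurs more than once in any row or in any column. Let $e=rc/v$, $e^-=\lfloor e\rfloor$, $e^+=\lceil e\rceil$. The design is equireplicate if $e$ is an integer and every symbol occurs exactly $e$ times, and near equireplicate if $e$ is not an integer and every symbol occurs $e^-$ or $e^+$ times. For a binary design, let $R_i$, $C_j$ be the symbol sets of row $i$ and column $j$, and put $\lambda_{rc}=\frac{1}{rc}\sum_{i,j}|R_i\cap C_j|$, $\lambda_{rr}=\binom{r}{2}^{ -1}\sum_{i<j}|R_i\cap R_j|$, $\lambda_{cc}=\binom{c}{2}^{ -1}\sum_{i<j}|C_i\cap C_j|$; for real $x$, $x^-=\lfloor x\rfloor$, $x^+=\lceil x\rceil$. An $(r\times c,v)$-near triple array is a binary $r\times c$ row-column design on $v$ symbols which is equireplicate or near equireplicate and in which every row and column share $\lambda_{rc}^-$ or $\lambda_{rc}^+$ symbols, every two distinct rows share $\lambda_{rr}^-$ or $\lambda_{rr}^+$ symbols, and every two distinct columns share $\lambda_{cc}^-$ or $\lambda_{cc}^+$ symbols. -}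

module Defs where

open import Data.Nat using (ℕ; zero; suc; _+_; _*_; _∸_; _≤_)
open import Data.Nat.DivMod using (_/_)
open import Data.Nat.Combinatorics using (_C_)
open import Data.Fin using (Fin; _≟_; _<?_)
open import Data.Bool using (Bool; true; false; if_then_else_; _∧_)
open import Data.List using (List; map; allFin)
open import Data.Nat.ListAction using (sum)
open import Data.Bool.ListAction using (any)
open import Data.Sum using (_⊎_)
open import Data.Product using (_×_)
open import Function.Definitions using (Injective)
open import Relation.Binary.PropositionalEquality using (_≡_)
open import Relation.Nullary.Decidable using (⌊_⌋)

Design : ℕ → ℕ → ℕ → Set
Design r c v = Fin r → Fin c → Fin v

sumFin : (n : ℕ) → (Fin n → ℕ) → ℕ
sumFin n f = sum (map f (allFin n))

countFin : (n : ℕ) → (Fin n → Bool) → ℕ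
countFin n p = sumFin n (λ x → if p x then 1 else 0)

-- floor and ceiling of a / b for natural numbers (b = 0 never used; returns 0)
floorDiv : ℕ → ℕ → ℕ
floorDiv a zero    = 0
floorDiv a (suc b) = a / suc b

ceilDiv : ℕ → ℕ → ℕ
ceilDiv a zero    = 0
ceilDiv a (suc b) = (a + b) / suc b

RoundOf : ℕ → ℕ → ℕ → Set
RoundOf a b n = (n ≡ floorDiv a b) ⊎ (n ≡ ceilDiv a b)

module _ {r c v : ℕ} (A : Design r c v) where

  Binary : Set
  Binary = (∀ i → Injective _≡_ _≡_ (λ j → A i j))
         × (∀ j → Injective _≡_ _≡_ (λ i → A i j))

  replication : Fin v → ℕ
  replication x = sumFin r (λ i → countFin c (λ j → ⌊ A i j ≟ x ⌋))

  -- equireplicate (e = rc/v integer, each symbol occurs e times) or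
  -- near equireplicate (e not integer, each symbol occurs ⌊e⌋ or ⌈e⌉ times)
  EquiOrNearEquireplicate : Set
  EquiOrNearEquireplicate = ∀ x → RoundOf (r * c) v (replication x)

  inRow : Fin r → Fin v → Bool
  inRow i x = any (λ j → ⌊ A i j ≟ x ⌋) (allFin c)

  inCol : Fin c → Fin v → Bool
  inCol j x = any (λ i → ⌊ A i j ≟ x ⌋) (allFin r)

  rowCol : Fin r → Fin c → ℕ
  rowCol i j = countFin v (λ x → inRow i x ∧ inCol j x)

  rowRow : Fin r → Fin r → ℕ
  rowRow i k = countFin v (λ x → inRow i x ∧ inRow k x)

  colCol : Fin c → Fin c → ℕ
  colCol j l = countFin v (λ x → inCol j x ∧ inCol l x)

  sumRC : ℕ
  sumRC = sumFin r (λ i → sumFin c (λ j → rowCol i j))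

  sumRR : ℕ
  sumRR = sumFin r (λ i → sumFin r (λ k → if ⌊ i <? k ⌋ then rowRow i k else 0))

  sumCC : ℕ
  sumCC = sumFin c (λ j → sumFin c (λ l → if ⌊ j <? l ⌋ then colCol j l else 0))

  -- λ_rc = sumRC / (rc), λ_rr = sumRR / (r choose 2), λ_cc = sumCC / (c choose 2)
  NearTripleArray : Set
  NearTripleArray =
      Binary
    × EquiOrNearEquireplicate
    × (∀ i j → RoundOf sumRC (r * c) (rowCol i j))
    × (∀ i k → i ≡ k ⊎ RoundOf sumRR (r C 2) (rowRow i k))
    × (∀ j l → j ≡ l ⊎ RoundOf sumCC (c C 2) (colCol j l))

{-# OPTIONS --safe #-}

-- If rc ≤ v, fill the array with distinct symbols. Otherwise let d = rc − v, so that
-- 2d ≤ c by hypothesis, and group 2d of the columns into d pairs. Every cell gets a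
-- fresh symbol, except that the second column of the s-th pair repeats, in row bₛ,
-- the entry of the first column in row aₛ, where aₛ < bₛ. Then every symbol occurs
-- once, twice (only if rc > v) or never (only if rc < v); a row and a column share
-- one or two symbols; two columns share at most one; and rows i < k share exactly as
-- many symbols as there are s with (aₛ , bₛ) = (i , k). Choosing the pairs (aₛ , bₛ)
-- round-robin among all pairs of rows makes these last counts differ by at most one.
-- All three λ conditions then follow from one observation: if a finite family of
-- naturals takes only two consecutive values, each member is the floor or the
-- ceiling of the mean.

module Submission where

open import Defs
open import Data.Fin as F using (Fin; zero; suc)
import Data.Fin.Properties as FP
open import Data.Nat using (ℕ; zero; suc; _+_; _*_; _∸_; _⊓_; _≤_; _<_; z≤n; s≤s; NonZero; >-nonZero)
open import Data.Nat.Properties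
open import Data.Nat.Tactic.RingSolver using (solve-∀)
open import Data.Nat.Combinatorics using (_C_; nC1≡n; nCk+nC[k+1]≡[n+1]C[k+1])
open import Data.Nat.DivMod using (_/_; _%_; m%n≤n; m≡m%n+[m/n]*n; m<n*o⇒m/o<n; m*n/n≡m; /-monoˡ-≤)
open import Algebra.Properties.CommutativeSemigroup +-commutativeSemigroup using (interchange)
open import Data.Bool using (Bool; true; false; T; if_then_else_; _∧_; _∨_)
open import Data.Bool.Properties using (T-∧; T-∨; ∧-comm)
open import Data.List using (List; []; _∷_; _++_; map; length; allFin; filter; cartesianProduct; concat; replicate; take; lookup)
open import Data.List.Properties using (map-++; map-∘; map-cong; length-map; length-++; length-tabulate; length-take; map-tabulate)
open import Data.Nat.ListAction using (sum)
open import Data.Nat.ListAction.Properties using (sum-++)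
open import Data.List.Relation.Unary.All as All using (All; []; _∷_)
import Data.List.Relation.Unary.All.Properties as Allₚ
open import Data.List.Relation.Unary.Any as Any using (Any; here; there)
import Data.List.Relation.Unary.Any.Properties as Anyₚ
open import Data.List.Relation.Unary.Unique.Propositional using (Unique; []; _∷_)
import Data.List.Relation.Unary.Unique.Propositional.Properties as Uniqueₚ
open import Data.List.Membership.Propositional using (_∈_; lose)
open import Data.List.Membership.Propositional.Properties using (∈-lookup; ∈-length; ∈-allFin; ∈-filter⁺; ∈-cartesianProduct⁺)
open import Data.Product using (Σ; ∃; _×_; _,_; proj₁; proj₂; uncurry)
open import Data.Sum as Sum using (_⊎_; inj₁; inj₂; [_,_]′)
open import Function using (_∘_; id)
open import Function.Bundles using (Equivalence; Inverse; Injection; _↔_)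
open import Function.Properties.Inverse using (↔-refl; ↔-sym; ↔-trans; ↔⇒↣)
open import Data.Sum.Function.Propositional using (_⊎-↔_)
open import Data.Product.Function.NonDependent.Propositional using (_×-↔_)
open import Data.Sum.Properties using (inj₁-injective)
open import Data.Product.Properties using (,-injective; ≡-dec)
open import Function.Definitions using (Injective)
open import Relation.Binary.PropositionalEquality
open import Relation.Binary.Definitions using (DecidableEquality; tri<; tri≈; tri>)
open import Relation.Nullary using (¬_; yes; no; contradiction)
open import Relation.Nullary.Decidable using (⌊_⌋; toWitness; fromWitness)
open import Relation.Unary using (Decidable)

private
  variable
    X Y : Set

∧-intro : ∀ {a b} → T a → T b → T (a ∧ b)
∧-intro {a} Ta Tb = Equivalence.from (T-∧ {a}) (Ta , Tb)

∧-elim : ∀ {a b} → T (a ∧ b) → T a × T b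
∧-elim {a} = Equivalence.to (T-∧ {a})

+-≤1 : ∀ m {t} → t ≤ 1 → m + t ≡ m ⊎ m + t ≡ suc m
+-≤1 m z≤n       = inj₁ (+-identityʳ m)
+-≤1 m (s≤s z≤n) = inj₂ (+-comm m 1)

1≤n≤2 : ∀ {n} → 1 ≤ n → n ≤ 2 → n ≡ 1 ⊎ n ≡ 2
1≤n≤2 {suc t} _ (s≤s t≤1) = +-≤1 1 t≤1

m+[n∸m]≡n+[m∸n] : ∀ m n → m + (n ∸ m) ≡ n + (m ∸ n)
m+[n∸m]≡n+[m∸n] m n with ≤-total m n
... | inj₁ m≤n = trans (m+[n∸m]≡n m≤n) (sym (trans (cong (n +_) (m≤n⇒m∸n≡0 m≤n)) (+-identityʳ n)))
... | inj₂ n≤m = trans (trans (cong (m +_) (m≤n⇒m∸n≡0 n≤m)) (+-identityʳ m)) (sym (m+[n∸m]≡n n≤m))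

count : (X → Bool) → List X → ℕ
count p xs = sum (map (λ x → if p x then 1 else 0) xs)

sum-map-+ : (f g : X → ℕ) (xs : List X) →
            sum (map (λ x → f x + g x) xs) ≡ sum (map f xs) + sum (map g xs)
sum-map-+ f g []       = refl
sum-map-+ f g (x ∷ xs) = trans (cong (f x + g x +_) (sum-map-+ f g xs)) (interchange (f x) (g x) _ _)

sum-map-mono : {f g : X → ℕ} {xs : List X} → All (λ x → f x ≤ g x) xs → sum (map f xs) ≤ sum (map g xs)
sum-map-mono []             = z≤n
sum-map-mono (fx≤gx ∷ f≤g) = +-mono-≤ fx≤gx (sum-map-mono f≤g)

sum-map-mono-< : {f g : X → ℕ} {xs : List X} → All (λ x → f x ≤ g x) xs → Any (λ x → f x < g x) xs →
                 sum (map f xs) < sum (map g xs)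
sum-map-mono-< (_     ∷ f≤g) (here fx<gx)  = +-mono-<-≤ fx<gx (sum-map-mono f≤g)
sum-map-mono-< (fx≤gx ∷ f≤g) (there f<g)   = +-mono-≤-< fx≤gx (sum-map-mono-< f≤g f<g)

sum-map-const : (b : ℕ) (xs : List X) → sum (map (λ _ → b) xs) ≡ b * length xs
sum-map-const b []       = sym (*-zeroʳ b)
sum-map-const b (x ∷ xs) = trans (cong (b +_) (sum-map-const b xs)) (sym (*-suc b (length xs)))

sum-map-zero : (xs : List X) → sum (map (λ _ → 0) xs) ≡ 0
sum-map-zero []       = refl
sum-map-zero (x ∷ xs) = sum-map-zero xs

length≡count-true : (xs : List X) → length xs ≡ count (λ _ → true) xs
length≡count-true []       = refl
length≡count-true (x ∷ xs) = cong suc (length≡count-true xs)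

sum-map-filter : {P : X → Set} (P? : Decidable P) (f : X → ℕ) (xs : List X) →
                 sum (map (λ x → if ⌊ P? x ⌋ then f x else 0) xs) ≡ sum (map f (filter P? xs))
sum-map-filter P? f []       = refl
sum-map-filter P? f (x ∷ xs) with P? x
... | yes _ = cong (f x +_) (sum-map-filter P? f xs)
... | no  _ = sum-map-filter P? f xs

sum-map-swap : (f : X → Y → ℕ) (xs : List X) (ys : List Y) →
               sum (map (λ x → sum (map (f x) ys)) xs) ≡ sum (map (λ y → sum (map (λ x → f x y) xs)) ys)
sum-map-swap f []       ys = sym (sum-map-zero ys)
sum-map-swap f (x ∷ xs) ys =
  trans (cong (sum (map (f x) ys) +_) (sum-map-swap f xs ys)) (sym (sum-map-+ (f x) _ ys))

sum-map-cartesianProduct : (f : X × Y → ℕ) (xs : List X) (ys : List Y) →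
  sum (map f (cartesianProduct xs ys)) ≡ sum (map (λ x → sum (map (λ y → f (x , y)) ys)) xs)
sum-map-cartesianProduct f []       ys = refl
sum-map-cartesianProduct f (x ∷ xs) ys = begin
  sum (map f (map (x ,_) ys ++ cartesianProduct xs ys))
    ≡⟨ cong sum (map-++ f (map (x ,_) ys) _) ⟩
  sum (map f (map (x ,_) ys) ++ map f (cartesianProduct xs ys))
    ≡⟨ sum-++ (map f (map (x ,_) ys)) _ ⟩
  sum (map f (map (x ,_) ys)) + sum (map f (cartesianProduct xs ys))
    ≡⟨ cong₂ _+_ (cong sum (sym (map-∘ ys))) (sum-map-cartesianProduct f xs ys) ⟩
  sum (map (λ y → f (x , y)) ys) + sum (map (λ x → sum (map (λ y → f (x , y)) ys)) xs) ∎
  where open ≡-Reasoning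

length-cartesianProduct : (xs : List X) (ys : List Y) →
                          length (cartesianProduct xs ys) ≡ length xs * length ys
length-cartesianProduct []       ys = refl
length-cartesianProduct (x ∷ xs) ys = begin
  length (map (x ,_) ys ++ cartesianProduct xs ys)    ≡⟨ length-++ (map (x ,_) ys) ⟩
  length (map (x ,_) ys) + length (cartesianProduct xs ys)
    ≡⟨ cong₂ _+_ (length-map (x ,_) ys) (length-cartesianProduct xs ys) ⟩
  length ys + length xs * length ys ∎
  where open ≡-Reasoning

module _ (p : X → Bool) where

  count-++ : (xs ys : List X) → count p (xs ++ ys) ≡ count p xs + count p ys
  count-++ xs ys = trans (cong sum (map-++ _ xs ys)) (sum-++ (map _ xs) _)

  count-≡0 : {xs : List X} → All (λ x → ¬ T (p x)) xs → count p xs ≡ 0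
  count-≡0 {[]}     []           = refl
  count-≡0 {x ∷ xs} (¬px ∷ ¬pxs) with p x
  ... | true  = contradiction _ ¬px
  ... | false = count-≡0 ¬pxs

  count-≥1 : {x : X} {xs : List X} → x ∈ xs → T (p x) → 1 ≤ count p xs
  count-≥1 {xs = y ∷ xs} (here refl) px with p y
  ... | true = s≤s z≤n
  count-≥1 {xs = y ∷ xs} (there x∈xs) px = ≤-trans (count-≥1 x∈xs px) (m≤n+m _ _)

count-mono : {p q : X → Bool} → (∀ x → T (p x) → T (q x)) → (xs : List X) → count p xs ≤ count q xs
count-mono {p = p} {q = q} p⇒q xs = sum-map-mono (All.universal indicator-mono xs)
  where
  indicator-mono : ∀ x → (if p x then 1 else 0) ≤ (if q x then 1 else 0)
  indicator-mono x with p x | q x | p⇒q x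
  ... | false | _     | _    = z≤n
  ... | true  | true  | _    = ≤-refl
  ... | true  | false | p⇒qx = contradiction (p⇒qx _) λ ()

count-∨ : (p q : X → Bool) (xs : List X) → count (λ x → p x ∨ q x) xs ≤ count p xs + count q xs
count-∨ p q xs = ≤-trans (sum-map-mono (All.universal indicator-∨ xs)) (≤-reflexive (sum-map-+ _ _ xs))
  where
  indicator-∨ : ∀ x → (if p x ∨ q x then 1 else 0) ≤ (if p x then 1 else 0) + (if q x then 1 else 0)
  indicator-∨ x with p x | q x
  ... | true  | _     = s≤s z≤n
  ... | false | true  = ≤-refl
  ... | false | false = z≤n

count-≟-≤1 : (_≟_ : DecidableEquality X) (y : X) {xs : List X} → Unique xs →
             count (λ x → ⌊ x ≟ y ⌋) xs ≤ 1
count-≟-≤1 _≟_ y {[]}     []               = z≤n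
count-≟-≤1 _≟_ y {x ∷ xs} (x∉xs ∷ unique) with x ≟ y
... | yes refl = ≤-reflexive (cong suc (count-≡0 _ (All.map (λ x≢z z≡x → x≢z (sym (toWitness z≡x))) x∉xs)))
... | no  _    = count-≟-≤1 _≟_ y unique

sumFin-cong : (n : ℕ) {f g : Fin n → ℕ} → (∀ x → f x ≡ g x) → sumFin n f ≡ sumFin n g
sumFin-cong n f≗g = cong sum (map-cong f≗g (allFin n))

sumFin-suc : (n : ℕ) (f : Fin (suc n) → ℕ) → sumFin (suc n) f ≡ f zero + sumFin n (f ∘ suc)
sumFin-suc n f = cong (λ xs → f zero + sum xs) (trans (map-tabulate suc f) (sym (map-tabulate id (f ∘ suc))))

sumFin-lookup : (f : X → ℕ) (xs : List X) → sumFin (length xs) (f ∘ lookup xs) ≡ sum (map f xs)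
sumFin-lookup f []       = refl
sumFin-lookup f (x ∷ xs) = trans (sumFin-suc (length xs) _) (cong (f x +_) (sumFin-lookup f xs))

module _ {n : ℕ} where

  countFin-≡0 : (p : Fin n → Bool) → (∀ x → ¬ T (p x)) → countFin n p ≡ 0
  countFin-≡0 p ¬p = count-≡0 p (All.universal ¬p (allFin n))

  countFin-≥1 : (p : Fin n → Bool) {a : Fin n} → T (p a) → 1 ≤ countFin n p
  countFin-≥1 p {a} = count-≥1 p (∈-allFin a)

  countFin-≟-≡1 : (a : Fin n) → countFin n (λ x → ⌊ x F.≟ a ⌋) ≡ 1
  countFin-≟-≡1 a = ≤-antisym (count-≟-≤1 F._≟_ a (Uniqueₚ.allFin⁺ n)) (countFin-≥1 _ (fromWitness {a? = a F.≟ a} refl))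

  countFin-≤1 : (p : Fin n → Bool) {a : Fin n} → (∀ x → T (p x) → x ≡ a) → countFin n p ≤ 1
  countFin-≤1 p {a} only-a = begin
    countFin n p                      ≤⟨ count-mono (λ x px → fromWitness (only-a x px)) (allFin n) ⟩
    countFin n (λ x → ⌊ x F.≟ a ⌋)    ≡⟨ countFin-≟-≡1 a ⟩
    1                                 ∎
    where open ≤-Reasoning

  countFin-≤2 : (p : Fin n → Bool) {a b : Fin n} → (∀ x → T (p x) → x ≡ a ⊎ x ≡ b) → countFin n p ≤ 2
  countFin-≤2 p {a} {b} only-ab = begin
    countFin n p                                       ≤⟨ count-mono (λ x px → either x (only-ab x px)) (allFin n) ⟩
    countFin n (λ x → ⌊ x F.≟ a ⌋ ∨ ⌊ x F.≟ b ⌋)        ≤⟨ count-∨ _ _ (allFin n) ⟩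
    countFin n (λ x → ⌊ x F.≟ a ⌋) + countFin n (λ x → ⌊ x F.≟ b ⌋)
                                                       ≡⟨ cong₂ _+_ (countFin-≟-≡1 a) (countFin-≟-≡1 b) ⟩
    2                                                  ∎
    where
    open ≤-Reasoning
    either : ∀ x → x ≡ a ⊎ x ≡ b → T (⌊ x F.≟ a ⌋ ∨ ⌊ x F.≟ b ⌋)
    either x (inj₁ x≡a) = Equivalence.from (T-∨ {⌊ x F.≟ a ⌋}) (inj₁ (fromWitness x≡a))
    either x (inj₂ x≡b) = Equivalence.from (T-∨ {⌊ x F.≟ a ⌋}) (inj₂ (fromWitness x≡b))

  countFin-≡1 : (p : Fin n → Bool) {a : Fin n} → T (p a) → (∀ x → T (p x) → x ≡ a) → countFin n p ≡ 1
  countFin-≡1 p pa only-a = ≤-antisym (countFin-≤1 p only-a) (countFin-≥1 p pa)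

countFin-image : {m n : ℕ} (g : Fin m → Fin n) → (∀ {s t} → g s ≡ g t → s ≡ t) →
                 (p : Fin n → Bool) (q : Fin m → Bool) →
                 (∀ x → T (p x) → ∃ λ s → g s ≡ x × T (q s)) → (∀ s → T (q s) → T (p (g s))) →
                 countFin n p ≡ countFin m q
countFin-image {m} {n} g g-injective p q p⇒image q⇒p = begin
  countFin n p                                              ≡⟨ sumFin-cong n preimages ⟩
  sumFin n (λ x → countFin m (λ s → q s ∧ ⌊ g s F.≟ x ⌋))   ≡⟨ sum-map-swap _ (allFin n) (allFin m) ⟩
  sumFin m (λ s → countFin n (λ x → q s ∧ ⌊ g s F.≟ x ⌋))   ≡⟨ sumFin-cong m image ⟩
  countFin m q                                              ∎
  where
  open ≡-Reasoning
  preimages : ∀ x → (if p x then 1 else 0) ≡ countFin m (λ s → q s ∧ ⌊ g s F.≟ x ⌋)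
  preimages x with p x in px≡
  ... | false = sym (countFin-≡0 _ no-preimage)
    where
    no-preimage : ∀ s → ¬ T (q s ∧ ⌊ g s F.≟ x ⌋)
    no-preimage s h with ∧-elim {q s} h
    ... | qs , gs≡x = subst T px≡ (subst (T ∘ p) (toWitness gs≡x) (q⇒p s qs))
  ... | true with p⇒image x (subst T (sym px≡) _)
  ...   | s , gs≡x , qs = sym (countFin-≡1 _ (∧-intro qs (fromWitness gs≡x)) only-s)
    where
    only-s : ∀ t → T (q t ∧ ⌊ g t F.≟ x ⌋) → t ≡ s
    only-s t h = g-injective (trans (toWitness (proj₂ (∧-elim {q t} h))) (sym gs≡x))
  image : ∀ s → countFin n (λ x → q s ∧ ⌊ g s F.≟ x ⌋) ≡ (if q s then 1 else 0)
  image s with q s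
  ... | true  = countFin-≡1 (λ x → ⌊ g s F.≟ x ⌋) (fromWitness refl) (λ x gs≡x → sym (toWitness gs≡x))
  ... | false = sum-map-zero (allFin n)

quotient-unique : {a n q : ℕ} .{{_ : NonZero n}} → q * n ≤ a → a < suc q * n → a / n ≡ q
quotient-unique {a} {n} {q} lo hi = ≤-antisym (≤-pred (m<n*o⇒m/o<n hi)) (begin
  q          ≡⟨ m*n/n≡m q n ⟨
  q * n / n  ≤⟨ /-monoˡ-≤ n lo ⟩
  a / n      ∎)
  where open ≤-Reasoning

roundOf-floor : {a n q : ℕ} → q * n ≤ a → a < suc q * n → RoundOf a n q
roundOf-floor {n = zero}  {q} _  hi = contradiction (≤-trans hi (≤-reflexive (*-zeroʳ (suc q)))) λ ()
roundOf-floor {n = suc n}     lo hi = inj₁ (sym (quotient-unique lo hi))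

roundOf-ceil : {a n q : ℕ} → q * n < a → a ≤ suc q * n → RoundOf a n (suc q)
roundOf-ceil {n = zero}  {q} lo hi = contradiction (≤-trans lo (≤-trans hi (≤-reflexive (*-zeroʳ (suc q))))) λ ()
roundOf-ceil {a} {suc n} {q} lo hi = inj₂ (sym (quotient-unique lo′ hi′))
  where
  open ≤-Reasoning
  lo′ : suc q * suc n ≤ a + n
  lo′ = begin
    suc n + q * suc n    ≡⟨ +-comm (suc n) _ ⟩
    q * suc n + suc n    ≡⟨ +-suc (q * suc n) n ⟩
    suc (q * suc n) + n  ≤⟨ +-monoˡ-≤ n lo ⟩
    a + n                ∎
  hi′ : a + n < suc (suc q) * suc n
  hi′ = begin-strict
    a + n                   ≤⟨ +-monoˡ-≤ n hi ⟩
    suc q * suc n + n       <⟨ +-monoʳ-< (suc q * suc n) (n<1+n n) ⟩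
    suc q * suc n + suc n   ≡⟨ +-comm _ (suc n) ⟩
    suc (suc q) * suc n     ∎

roundOf-1 : ∀ {a b} → 0 < a → a < 2 * b → RoundOf a b 1
roundOf-1 {a} {b} 0<a a<2b with ≤-<-connex a b
... | inj₁ a≤b = roundOf-ceil 0<a (≤-trans a≤b (≤-reflexive (sym (+-identityʳ b))))
... | inj₂ b<a = roundOf-floor (≤-trans (≤-reflexive (+-identityʳ b)) (<⇒≤ b<a)) a<2b

module _ (f : X → ℕ) {q : ℕ} {xs : List X} (two-values : ∀ {y} → y ∈ xs → f y ≡ q ⊎ f y ≡ suc q) where

  private
    sum-const-≤ : {b : ℕ} → All (λ y → b ≤ f y) xs → b * length xs ≤ sum (map f xs)
    sum-const-≤ {b} b≤f = subst (_≤ sum (map f xs)) (sum-map-const b xs) (sum-map-mono b≤f)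

    sum-const-< : {b : ℕ} → All (λ y → b ≤ f y) xs → Any (λ y → b < f y) xs → b * length xs < sum (map f xs)
    sum-const-< {b} b≤f b<f = subst (_< sum (map f xs)) (sum-map-const b xs) (sum-map-mono-< b≤f b<f)

    sum-≤-const : {b : ℕ} → All (λ y → f y ≤ b) xs → sum (map f xs) ≤ b * length xs
    sum-≤-const {b} f≤b = subst (sum (map f xs) ≤_) (sum-map-const b xs) (sum-map-mono f≤b)

    sum-<-const : {b : ℕ} → All (λ y → f y ≤ b) xs → Any (λ y → f y < b) xs → sum (map f xs) < b * length xs
    sum-<-const {b} f≤b f<b = subst (sum (map f xs) <_) (sum-map-const b xs) (sum-map-mono-< f≤b f<b)

    q≤f : All (λ y → q ≤ f y) xs
    q≤f = All.tabulate λ y∈xs →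
      [ ≤-reflexive ∘ sym , (λ fy≡1+q → ≤-trans (n≤1+n q) (≤-reflexive (sym fy≡1+q))) ]′ (two-values y∈xs)

    f≤1+q : All (λ y → f y ≤ suc q) xs
    f≤1+q = All.tabulate λ y∈xs →
      [ (λ fy≡q → ≤-trans (≤-reflexive fy≡q) (n≤1+n q)) , ≤-reflexive ]′ (two-values y∈xs)

  roundOf-mean : {x : X} → x ∈ xs → RoundOf (sum (map f xs)) (length xs) (f x)
  roundOf-mean x∈xs with two-values x∈xs
  ... | inj₁ fx≡q   = subst (RoundOf (sum (map f xs)) (length xs)) (sym fx≡q)
                        (roundOf-floor (sum-const-≤ q≤f)
                                       (sum-<-const f≤1+q (Any.map (λ { refl → s≤s (≤-reflexive fx≡q) }) x∈xs)))
  ... | inj₂ fx≡1+q = subst (RoundOf (sum (map f xs)) (length xs)) (sym fx≡1+q)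
                        (roundOf-ceil (sum-const-< q≤f (Any.map (λ { refl → ≤-reflexive (sym fx≡1+q) }) x∈xs))
                                      (sum-≤-const f≤1+q))

cells : (a b : ℕ) → List (Fin a × Fin b)
cells a b = cartesianProduct (allFin a) (allFin b)

Ordered : {n : ℕ} → Fin n × Fin n → Set
Ordered (i , k) = i F.< k

ordered? : {n : ℕ} → Decidable (Ordered {n})
ordered? (i , k) = i F.<? k

orderedPairs : (n : ℕ) → List (Fin n × Fin n)
orderedPairs n = filter ordered? (cells n n)

length-allFin : (n : ℕ) → length (allFin n) ≡ n
length-allFin n = length-tabulate id

length-cells : (a b : ℕ) → length (cells a b) ≡ a * b
length-cells a b = trans (length-cartesianProduct (allFin a) (allFin b)) (cong₂ _*_ (length-allFin a) (length-allFin b))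

sumFin²≡sum-cells : {a b : ℕ} (f : Fin a → Fin b → ℕ) →
                    sumFin a (λ i → sumFin b (f i)) ≡ sum (map (uncurry f) (cells a b))
sumFin²≡sum-cells {a} {b} f = sym (sum-map-cartesianProduct (uncurry f) (allFin a) (allFin b))

sumFin²-<≡sum-orderedPairs : {n : ℕ} (f : Fin n → Fin n → ℕ) →
  sumFin n (λ i → sumFin n (λ k → if ⌊ i F.<? k ⌋ then f i k else 0)) ≡ sum (map (uncurry f) (orderedPairs n))
sumFin²-<≡sum-orderedPairs {n} f =
  trans (sumFin²≡sum-cells (λ i k → if ⌊ i F.<? k ⌋ then f i k else 0)) (sum-map-filter ordered? (uncurry f) (cells n n))

<?-suc : {n : ℕ} (i k : Fin n) → ⌊ suc i F.<? suc k ⌋ ≡ ⌊ i F.<? k ⌋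
<?-suc i k with i F.<? k | suc i F.<? suc k
... | yes _   | yes _     = refl
... | no  _   | no  _     = refl
... | yes i<k | no  i≮k   = contradiction (s≤s i<k) i≮k
... | no  i≮k | yes 1+i<k = contradiction (≤-pred 1+i<k) i≮k

countFin-zero< : (n : ℕ) → countFin (suc n) (λ k → ⌊ F.zero {n} F.<? k ⌋) ≡ n
countFin-zero< n = begin
  countFin (suc n) (λ k → ⌊ F.zero {n} F.<? k ⌋)  ≡⟨ sumFin-suc n (λ k → if ⌊ F.zero {n} F.<? k ⌋ then 1 else 0) ⟩
  countFin n (λ _ → true)                         ≡⟨ length≡count-true (allFin n) ⟨
  length (allFin n)                               ≡⟨ length-allFin n ⟩
  n                                               ∎
  where open ≡-Reasoning

countFin-suc< : {n : ℕ} (i : Fin n) → countFin (suc n) (λ k → ⌊ suc i F.<? k ⌋) ≡ countFin n (λ k → ⌊ i F.<? k ⌋)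
countFin-suc< {n} i = trans (sumFin-suc n (λ k → if ⌊ suc i F.<? k ⌋ then 1 else 0))
                            (sumFin-cong n (λ k → cong (λ b → if b then 1 else 0) (<?-suc i k)))

sumFin-countFin-< : (n : ℕ) → sumFin n (λ i → countFin n (λ k → ⌊ i F.<? k ⌋)) ≡ n C 2
sumFin-countFin-< zero    = refl
sumFin-countFin-< (suc n) = begin
  sumFin (suc n) (λ i → countFin (suc n) (λ k → ⌊ i F.<? k ⌋))
    ≡⟨ sumFin-suc n (λ i → countFin (suc n) (λ k → ⌊ i F.<? k ⌋)) ⟩
  countFin (suc n) (λ k → ⌊ F.zero {n} F.<? k ⌋) + sumFin n (λ i → countFin (suc n) (λ k → ⌊ suc i F.<? k ⌋))
    ≡⟨ cong₂ _+_ (countFin-zero< n) (trans (sumFin-cong n countFin-suc<) (sumFin-countFin-< n)) ⟩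
  n + n C 2
    ≡⟨ cong (_+ n C 2) (nC1≡n n) ⟨
  n C 1 + n C 2
    ≡⟨ nCk+nC[k+1]≡[n+1]C[k+1] n 1 ⟩
  suc n C 2 ∎
  where open ≡-Reasoning

length-orderedPairs : (n : ℕ) → length (orderedPairs n) ≡ n C 2
length-orderedPairs n = begin
  length (orderedPairs n)                           ≡⟨ length≡count-true (orderedPairs n) ⟩
  sum (map (λ _ → 1) (orderedPairs n))              ≡⟨ sumFin²-<≡sum-orderedPairs {n} (λ _ _ → 1) ⟨
  sumFin n (λ i → countFin n (λ k → ⌊ i F.<? k ⌋))  ≡⟨ sumFin-countFin-< n ⟩
  n C 2                                             ∎
  where open ≡-Reasoning

orderedPairs-unique : (n : ℕ) → Unique (orderedPairs n)
orderedPairs-unique n = Uniqueₚ.filter⁺ _ (Uniqueₚ.cartesianProduct⁺ (Uniqueₚ.allFin⁺ n) (Uniqueₚ.allFin⁺ n))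

_≟²_ : {n : ℕ} → DecidableEquality (Fin n × Fin n)
_≟²_ = ≡-dec F._≟_ F._≟_

∈-orderedPairs⁺ : {n : ℕ} {i k : Fin n} → i F.< k → (i , k) ∈ orderedPairs n
∈-orderedPairs⁺ {i = i} {k} = ∈-filter⁺ ordered? (∈-cartesianProduct⁺ (∈-allFin i) (∈-allFin k))

orderedPairs-ordered : (n : ℕ) → All Ordered (orderedPairs n)
orderedPairs-ordered n = Allₚ.all-filter ordered? (cells n n)

roundRobin : List X → ℕ → ℕ → List X
roundRobin xs rounds extra = concat (replicate rounds xs) ++ take extra xs

count-roundRobin : (p : X → Bool) (xs : List X) (rounds extra : ℕ) →
                   count p (roundRobin xs rounds extra) ≡ rounds * count p xs + count p (take extra xs)
count-roundRobin p xs rounds extra =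
  trans (count-++ p (concat (replicate rounds xs)) _) (cong (_+ count p (take extra xs)) (rounds-count rounds))
  where
  rounds-count : ∀ rounds → count p (concat (replicate rounds xs)) ≡ rounds * count p xs
  rounds-count zero         = refl
  rounds-count (suc rounds) = trans (count-++ p xs _) (cong (count p xs +_) (rounds-count rounds))

roundRobin-balanced : (_≟_ : DecidableEquality X) {xs : List X} → Unique xs → (rounds extra : ℕ) →
                      {y : X} → y ∈ xs → let c = count (λ x → ⌊ x ≟ y ⌋) (roundRobin xs rounds extra) in
                      c ≡ rounds ⊎ c ≡ suc rounds
roundRobin-balanced _≟_ {xs} unique rounds extra {y} y∈xs =
  subst (λ c → c ≡ rounds ⊎ c ≡ suc rounds) (sym total) (+-≤1 rounds (count-≟-≤1 _≟_ y (Uniqueₚ.take⁺ extra unique)))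
  where
  occurrences : List _ → ℕ
  occurrences = count (λ x → ⌊ x ≟ y ⌋)
  once : occurrences xs ≡ 1
  once = ≤-antisym (count-≟-≤1 _≟_ y unique) (count-≥1 _ y∈xs (fromWitness refl))
  total : occurrences (roundRobin xs rounds extra) ≡ rounds + occurrences (take extra xs)
  total = trans (count-roundRobin _ xs rounds extra)
                (cong (_+ occurrences (take extra xs)) (trans (cong (rounds *_) once) (*-identityʳ rounds)))

length-roundRobin : (xs : List X) (rounds : ℕ) {extra : ℕ} → extra ≤ length xs →
                    length (roundRobin xs rounds extra) ≡ rounds * length xs + extra
length-roundRobin xs rounds {extra} extra≤ = begin
  length (roundRobin xs rounds extra)                           ≡⟨ length-++ (concat (replicate rounds xs)) ⟩
  length (concat (replicate rounds xs)) + length (take extra xs) ≡⟨ cong₂ _+_ (rounds-length rounds) (length-take extra xs) ⟩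
  rounds * length xs + extra ⊓ length xs                        ≡⟨ cong (rounds * length xs +_) (m≤n⇒m⊓n≡m extra≤) ⟩
  rounds * length xs + extra                                    ∎
  where
  open ≡-Reasoning
  rounds-length : ∀ rounds → length (concat (replicate rounds xs)) ≡ rounds * length xs
  rounds-length zero         = refl
  rounds-length (suc rounds) = trans (length-++ xs) (cong (length xs +_) (rounds-length rounds))

All-roundRobin : {P : X → Set} {xs : List X} → All P xs → (rounds extra : ℕ) → All P (roundRobin xs rounds extra)
All-roundRobin Pxs rounds extra = Allₚ.++⁺ (Allₚ.concat⁺ (Allₚ.replicate⁺ rounds Pxs)) (Allₚ.take⁺ extra Pxs)

roundOf-cells : {a b q : ℕ} (f : Fin a → Fin b → ℕ) → (∀ i j → f i j ≡ q ⊎ f i j ≡ suc q) →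
                ∀ i j → RoundOf (sumFin a (λ i → sumFin b (f i))) (a * b) (f i j)
roundOf-cells {a} {b} f two-values i j =
  subst₂ (λ total size → RoundOf total size (f i j)) (sym (sumFin²≡sum-cells f)) (length-cells a b)
         (roundOf-mean (uncurry f) (λ {y} _ → two-values (proj₁ y) (proj₂ y))
                       (∈-cartesianProduct⁺ (∈-allFin i) (∈-allFin j)))

module _ {n q : ℕ} (f : Fin n → Fin n → ℕ) (two-values : ∀ {i k} → i F.< k → f i k ≡ q ⊎ f i k ≡ suc q) where

  roundOf-< : ∀ {i k} → i F.< k →
              RoundOf (sumFin n (λ i → sumFin n (λ k → if ⌊ i F.<? k ⌋ then f i k else 0))) (n C 2) (f i k)
  roundOf-< i<k =
    subst₂ (λ total size → RoundOf total size _) (sym (sumFin²-<≡sum-orderedPairs f)) (length-orderedPairs n)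
           (roundOf-mean (uncurry f) (λ y∈ → two-values (All.lookup (orderedPairs-ordered n) y∈)) (∈-orderedPairs⁺ i<k))

  roundOf-orderedPairs : (∀ i k → f i k ≡ f k i) →
    ∀ i k → i ≡ k ⊎ RoundOf (sumFin n (λ i → sumFin n (λ k → if ⌊ i F.<? k ⌋ then f i k else 0))) (n C 2) (f i k)
  roundOf-orderedPairs symmetric i k with FP.<-cmp i k
  ... | tri< i<k _ _ = inj₂ (roundOf-< i<k)
  ... | tri≈ _ i≡k _ = inj₁ i≡k
  ... | tri> _ _ k<i = inj₂ (subst (RoundOf _ (n C 2)) (symmetric k i) (roundOf-< k<i))

module _ {r c v : ℕ} (A : Design r c v) where

  inRow⁻ : ∀ {i x} → T (inRow A i x) → ∃ λ j → A i j ≡ x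
  inRow⁻ x∈Rᵢ = let j , Aij≟x = Any.satisfied (Anyₚ.any⁻ _ (allFin c) x∈Rᵢ) in j , toWitness Aij≟x

  inRow⁺ : ∀ {i j x} → A i j ≡ x → T (inRow A i x)
  inRow⁺ {j = j} Aij≡x = Anyₚ.any⁺ _ (lose (∈-allFin j) (fromWitness Aij≡x))

  inCol⁻ : ∀ {j x} → T (inCol A j x) → ∃ λ i → A i j ≡ x
  inCol⁻ x∈Cⱼ = let i , Aij≟x = Any.satisfied (Anyₚ.any⁻ _ (allFin r) x∈Cⱼ) in i , toWitness Aij≟x

  inCol⁺ : ∀ {i j x} → A i j ≡ x → T (inCol A j x)
  inCol⁺ {i = i} Aij≡x = Anyₚ.any⁺ _ (lose (∈-allFin i) (fromWitness Aij≡x))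

  rowRow-comm : ∀ i k → rowRow A i k ≡ rowRow A k i
  rowRow-comm i k = sumFin-cong v λ x → cong (λ b → if b then 1 else 0) (∧-comm (inRow A i x) (inRow A k x))

  colCol-comm : ∀ j l → colCol A j l ≡ colCol A l j
  colCol-comm j l = sumFin-cong v λ x → cong (λ b → if b then 1 else 0) (∧-comm (inCol A j x) (inCol A l x))

  replication≡rows : (∀ i → Injective _≡_ _≡_ (A i)) → ∀ x → replication A x ≡ countFin r (λ i → inRow A i x)
  replication≡rows rows-injective x = sumFin-cong r row-count
    where
    row-count : ∀ i → countFin c (λ j → ⌊ A i j F.≟ x ⌋) ≡ (if inRow A i x then 1 else 0)
    row-count i with inRow A i x | inRow⁻ {i} {x} | (λ {j} → inRow⁺ {i} {j} {x})
    ... | true  | witness | _ =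
      let j , Aij≡x = witness _ in
      countFin-≡1 (λ j → ⌊ A i j F.≟ x ⌋) (fromWitness Aij≡x)
                  (λ j′ Aij′≟x → rows-injective i (trans (toWitness Aij′≟x) (sym Aij≡x)))
    ... | false | _ | no-witness = countFin-≡0 (λ j → ⌊ A i j F.≟ x ⌋) (λ j Aij≟x → no-witness (toWitness Aij≟x))

module Construction (r′ : ℕ) (schedule : List (Fin (suc r′) × Fin (suc r′))) (schedule-ordered : All Ordered schedule)
                    (e f c v : ℕ) (c≡ : c ≡ length schedule * 2 + e)
                    (v≡ : v ≡ length schedule * (suc r′ + r′) + e * suc r′ + f) where

  r d : ℕ
  r = suc r′
  d = length schedule

  top bottom : Fin d → Fin r
  top    s = proj₁ (lookup schedule s)
  bottom s = proj₂ (lookup schedule s)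

  top<bottom : ∀ s → top s F.< bottom s
  top<bottom s = All.lookup schedule-ordered (∈-lookup s)

  top≢bottom : ∀ s → top s ≢ bottom s
  top≢bottom s = FP.<⇒≢ (top<bottom s)

  -- The s-th pair of columns uses r + r′ = 2r − 1 symbols, as one symbol occurs in both.
  Column Symbol Cell : Set
  Column = (Fin d × Fin 2) ⊎ Fin e
  Symbol = (Fin d × (Fin r ⊎ Fin r′)) ⊎ (Fin e × Fin r)
  Cell   = Fin r × Column

  opaque
    columns : Fin c ↔ Column
    columns = subst (λ n → Fin n ↔ Column) (sym c≡) (↔-trans FP.+↔⊎ (FP.*↔× ⊎-↔ ↔-refl))

    symbols : (Symbol ⊎ Fin f) ↔ Fin v
    symbols = subst (λ n → (Symbol ⊎ Fin f) ↔ Fin n) (sym v≡)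
                    (↔-sym (↔-trans FP.+↔⊎
                                    (↔-trans FP.+↔⊎ ((↔-trans FP.*↔× (↔-refl ×-↔ FP.+↔⊎)) ⊎-↔ FP.*↔×) ⊎-↔ ↔-refl)))

  column : Fin c → Column
  column = Inverse.to columns

  column-injective : ∀ {j l} → column j ≡ column l → j ≡ l
  column-injective = Injection.injective (↔⇒↣ columns)

  encode : Symbol → Fin v
  encode y = Inverse.to symbols (inj₁ y)

  encode-injective : ∀ {y y′} → encode y ≡ encode y′ → y ≡ y′
  encode-injective = inj₁-injective ∘ Injection.injective (↔⇒↣ symbols)

  shared : Fin d → Symbol
  shared s = inj₁ (s , inj₁ (top s))

  shared-injective : ∀ {s s′} → shared s ≡ shared s′ → s ≡ s′
  shared-injective = proj₁ ∘ ,-injective ∘ inj₁-injective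

  -- Outside row bottom s, column (s , 1) numbers its fresh symbols by the other r − 1 rows.
  label : Fin r → Column → Symbol
  label i (inj₁ (s , zero))     = inj₁ (s , inj₁ i)
  label i (inj₁ (s , suc zero)) with bottom s F.≟ i
  ... | yes _   = shared s
  ... | no  b≢i = inj₁ (s , inj₂ (F.punchOut b≢i))
  label i (inj₂ m)              = inj₂ (m , i)

  A : Design r c v
  A i j = encode (label i (column j))

  topCell bottomCell : Fin d → Cell
  topCell    s = top s , inj₁ (s , zero)
  bottomCell s = bottom s , inj₁ (s , suc zero)

  position : Symbol → Cell
  position (inj₁ (s , inj₁ i)) = i , inj₁ (s , zero)
  position (inj₁ (s , inj₂ u)) = F.punchIn (bottom s) u , inj₁ (s , suc zero)
  position (inj₂ (m , i))      = i , inj₂ m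

  label-position : ∀ y → uncurry label (position y) ≡ y
  label-position (inj₁ (s , inj₁ i)) = refl
  label-position (inj₁ (s , inj₂ u)) with bottom s F.≟ F.punchIn (bottom s) u
  ... | yes b≡ = contradiction (sym b≡) (FP.punchInᵢ≢i (bottom s) u)
  ... | no  _  = cong (λ u′ → inj₁ (s , inj₂ u′)) (trans (FP.punchOut-cong (bottom s) refl) (FP.punchOut-punchIn (bottom s)))
  label-position (inj₂ (m , i))      = refl

  label-bottomCell : ∀ s → uncurry label (bottomCell s) ≡ shared s
  label-bottomCell s with bottom s F.≟ bottom s
  ... | yes _   = refl
  ... | no  b≢b = contradiction refl b≢b

  label-cases : ∀ x → x ≡ position (uncurry label x) ⊎ ∃ λ s → uncurry label x ≡ shared s × x ≡ bottomCell s
  label-cases (i , inj₁ (s , zero))     = inj₁ refl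
  label-cases (i , inj₁ (s , suc zero)) with bottom s F.≟ i
  ... | yes refl = inj₂ (s , refl , refl)
  ... | no  b≢i  = inj₁ (cong (_, inj₁ (s , suc zero)) (sym (FP.punchIn-punchOut b≢i)))
  label-cases (i , inj₂ m)              = inj₁ refl

  Twins : Fin d → Cell → Cell → Set
  Twins s x x′ = (x ≡ topCell s × x′ ≡ bottomCell s) ⊎ (x ≡ bottomCell s × x′ ≡ topCell s)

  same-label : ∀ x x′ → uncurry label x ≡ uncurry label x′ →
               x ≡ x′ ⊎ ∃ λ s → uncurry label x ≡ shared s × Twins s x x′
  same-label x x′ ℓx≡ℓx′ with label-cases x | label-cases x′
  ... | inj₁ x≡pos | inj₁ x′≡pos =
    inj₁ (trans x≡pos (trans (cong position ℓx≡ℓx′) (sym x′≡pos)))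
  ... | inj₁ x≡pos | inj₂ (s , ℓx′≡ , x′≡bottom) =
    inj₂ (s , trans ℓx≡ℓx′ ℓx′≡ , inj₁ (trans x≡pos (cong position (trans ℓx≡ℓx′ ℓx′≡)) , x′≡bottom))
  ... | inj₂ (s , ℓx≡ , x≡bottom) | inj₁ x′≡pos =
    inj₂ (s , ℓx≡ , inj₂ (x≡bottom , trans x′≡pos (cong position (trans (sym ℓx≡ℓx′) ℓx≡))))
  ... | inj₂ (s , ℓx≡ , x≡bottom) | inj₂ (s′ , ℓx′≡ , x′≡bottom)
    with shared-injective (trans (sym ℓx≡) (trans ℓx≡ℓx′ ℓx′≡))
  ...   | refl = inj₁ (trans x≡bottom (sym x′≡bottom))

  -- Single columns contain no shared symbol; the value there is arbitrary.
  partner : Column → Symbol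
  partner (inj₁ (s , _)) = shared s
  partner (inj₂ m)       = inj₂ (m , zero)

  twins-rows : ∀ {s x x′} → Twins s x x′ → proj₁ x ≢ proj₁ x′
  twins-rows {s} (inj₁ (refl , refl)) = top≢bottom s
  twins-rows {s} (inj₂ (refl , refl)) = top≢bottom s ∘ sym

  twins-columns : ∀ {s x x′} → Twins s x x′ → proj₂ x ≢ proj₂ x′
  twins-columns (inj₁ (refl , refl)) ()
  twins-columns (inj₂ (refl , refl)) ()

  twins-partner : ∀ {s x x′} → Twins s x x′ → partner (proj₂ x) ≡ shared s × partner (proj₂ x′) ≡ shared s
  twins-partner (inj₁ (refl , refl)) = refl , refl
  twins-partner (inj₂ (refl , refl)) = refl , refl

  label-injectiveʳ : ∀ i {w w′} → label i w ≡ label i w′ → w ≡ w′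
  label-injectiveʳ i {w} {w′} ℓ≡ with same-label (i , w) (i , w′) ℓ≡
  ... | inj₁ x≡x′            = cong proj₂ x≡x′
  ... | inj₂ (_ , _ , twins) = contradiction refl (twins-rows twins)

  label-injectiveˡ : ∀ w {i i′} → label i w ≡ label i′ w → i ≡ i′
  label-injectiveˡ w {i} {i′} ℓ≡ with same-label (i , w) (i′ , w) ℓ≡
  ... | inj₁ x≡x′            = cong proj₁ x≡x′
  ... | inj₂ (_ , _ , twins) = contradiction refl (twins-columns twins)

  row∩column : ∀ {i i′ w w′} → label i w′ ≡ label i′ w → label i′ w ≡ label i w ⊎ label i′ w ≡ partner w
  row∩column {i} {i′} {w} {w′} ℓ≡ with same-label (i , w′) (i′ , w) ℓ≡
  ... | inj₁ refl                    = inj₁ refl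
  ... | inj₂ (s , ℓ≡shared , twins) = inj₂ (trans (sym ℓ≡) (trans ℓ≡shared (sym (proj₂ (twins-partner twins)))))

  column∩column : ∀ {i i′ w w′} → w ≢ w′ → label i w ≡ label i′ w′ → label i w ≡ partner w
  column∩column {i} {i′} {w} {w′} w≢w′ ℓ≡ with same-label (i , w) (i′ , w′) ℓ≡
  ... | inj₁ x≡x′                    = contradiction (cong proj₂ x≡x′) w≢w′
  ... | inj₂ (s , ℓ≡shared , twins) = trans ℓ≡shared (sym (proj₁ (twins-partner twins)))

  row∩row : ∀ {i k w w′} → i F.< k → label i w ≡ label k w′ →
            ∃ λ s → label i w ≡ shared s × top s ≡ i × bottom s ≡ k
  row∩row {i} {k} {w} {w′} i<k ℓ≡ with same-label (i , w) (k , w′) ℓ≡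
  ... | inj₁ x≡x′ = contradiction (cong proj₁ x≡x′) (FP.<⇒≢ i<k)
  ... | inj₂ (s , ℓ≡shared , inj₁ (x≡top , x′≡bottom)) =
    s , ℓ≡shared , sym (cong proj₁ x≡top) , sym (cong proj₁ x′≡bottom)
  ... | inj₂ (s , ℓ≡shared , inj₂ (x≡bottom , x′≡top)) =
    contradiction (subst₂ F._<_ (cong proj₁ x≡bottom) (cong proj₁ x′≡top) i<k)
                  (<⇒≯ (top<bottom s))

  A≡⇒label≡ : ∀ {i j i′ j′} → A i j ≡ A i′ j′ → label i (column j) ≡ label i′ (column j′)
  A≡⇒label≡ {i} {j} {i′} {j′} = encode-injective {label i (column j)} {label i′ (column j′)}

  A-at : ∀ x → A (proj₁ x) (Inverse.from columns (proj₂ x)) ≡ encode (uncurry label x)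
  A-at (i , w) = cong (encode ∘ label i) (Inverse.strictlyInverseˡ columns w)

  binary : Binary A
  binary = (λ i → column-injective ∘ label-injectiveʳ i ∘ A≡⇒label≡)
         , (λ j → label-injectiveˡ (column j) ∘ A≡⇒label≡)

  rowCol-values : ∀ i j → rowCol A i j ≡ 1 ⊎ rowCol A i j ≡ 2
  rowCol-values i j = 1≤n≤2 (countFin-≥1 P (∧-intro (inRow⁺ A refl) (inCol⁺ A refl))) (countFin-≤2 P candidates)
    where
    P : Fin v → Bool
    P x = inRow A i x ∧ inCol A j x
    candidates : ∀ x → T (P x) → x ≡ A i j ⊎ x ≡ encode (partner (column j))
    candidates x x∈ with ∧-elim {inRow A i x} x∈
    ... | x∈Rᵢ , x∈Cⱼ with inRow⁻ A x∈Rᵢ | inCol⁻ A x∈Cⱼ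
    ... | j′ , Aij′≡x | i′ , Ai′j≡x =
      Sum.map (λ ℓ≡ → trans (sym Ai′j≡x) (cong encode ℓ≡)) (λ ℓ≡ → trans (sym Ai′j≡x) (cong encode ℓ≡))
              (row∩column {i} {i′} {column j} {column j′} (A≡⇒label≡ {i} {j′} {i′} {j} (trans Aij′≡x (sym Ai′j≡x))))

  colCol-values : ∀ {j l} → j ≢ l → colCol A j l ≡ 0 ⊎ colCol A j l ≡ 1
  colCol-values {j} {l} j≢l = +-≤1 0 (countFin-≤1 P only-partner)
    where
    P : Fin v → Bool
    P x = inCol A j x ∧ inCol A l x
    only-partner : ∀ x → T (P x) → x ≡ encode (partner (column j))
    only-partner x x∈ with ∧-elim {inCol A j x} x∈
    ... | x∈Cⱼ , x∈Cₗ with inCol⁻ A x∈Cⱼ | inCol⁻ A x∈Cₗ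
    ... | i , Aij≡x | i′ , Ai′l≡x =
      trans (sym Aij≡x) (cong encode (column∩column {i} {i′} {column j} {column l} (j≢l ∘ column-injective)
                                                    (A≡⇒label≡ {i} {j} {i′} {l} (trans Aij≡x (sym Ai′l≡x)))))

  rowRow-count : ∀ {i k} → i F.< k → rowRow A i k ≡ count (λ p → ⌊ p ≟² (i , k) ⌋) schedule
  rowRow-count {i} {k} i<k =
    trans (countFin-image (encode ∘ shared) (shared-injective ∘ encode-injective) P Q common⇒shared shared⇒common)
          (sumFin-lookup _ schedule)
    where
    P : Fin v → Bool
    P x = inRow A i x ∧ inRow A k x
    Q : Fin d → Bool
    Q s = ⌊ lookup schedule s ≟² (i , k) ⌋
    common⇒shared : ∀ x → T (P x) → ∃ λ s → encode (shared s) ≡ x × T (Q s)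
    common⇒shared x x∈ with ∧-elim {inRow A i x} x∈
    ... | x∈Rᵢ , x∈Rₖ with inRow⁻ A x∈Rᵢ | inRow⁻ A x∈Rₖ
    ... | j , Aij≡x | j′ , Akj′≡x
      with row∩row {i} {k} {column j} {column j′} i<k (A≡⇒label≡ {i} {j} {k} {j′} (trans Aij≡x (sym Akj′≡x)))
    ... | s , ℓ≡shared , top≡i , bottom≡k =
      s , trans (cong encode (sym ℓ≡shared)) Aij≡x , fromWitness (cong₂ _,_ top≡i bottom≡k)
    shared⇒common : ∀ s → T (Q s) → T (P (encode (shared s)))
    shared⇒common s Qs = ∧-intro
      (subst (λ i → T (inRow A i _)) (cong proj₁ (toWitness Qs)) (inRow⁺ A (A-at (topCell s))))
      (subst (λ k → T (inRow A k _)) (cong proj₂ (toWitness Qs))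
             (inRow⁺ A (trans (A-at (bottomCell s)) (cong encode (label-bottomCell s)))))

  rows-containing : ∀ {i} y → T (inRow A i (encode y)) → i ≡ proj₁ (position y) ⊎ ∃ λ s → y ≡ shared s × i ≡ bottom s
  rows-containing {i} y y∈Rᵢ with inRow⁻ A y∈Rᵢ
  ... | j , Aij≡ with encode-injective {label i (column j)} Aij≡ | label-cases (i , column j)
  ... | refl | inj₁ cell≡position                = inj₁ (cong proj₁ cell≡position)
  ... | refl | inj₂ (s , ℓ≡shared , cell≡bottom) = inj₂ (s , ℓ≡shared , cong proj₁ cell≡bottom)

  position-row-contains : ∀ y → T (inRow A (proj₁ (position y)) (encode y))
  position-row-contains y = inRow⁺ A (trans (A-at (position y)) (cong encode (label-position y)))

  rows-of-padding : ∀ z → countFin r (λ i → inRow A i (Inverse.to symbols (inj₂ z))) ≡ 0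
  rows-of-padding z = countFin-≡0 _ no-row
    where
    no-row : ∀ i → ¬ T (inRow A i (Inverse.to symbols (inj₂ z)))
    no-row i z∈Rᵢ with Injection.injective (↔⇒↣ symbols) (proj₂ (inRow⁻ A z∈Rᵢ))
    ... | ()

  rows-of-single : ∀ m i₀ → countFin r (λ i → inRow A i (encode (inj₂ (m , i₀)))) ≡ 1
  rows-of-single m i₀ = countFin-≡1 (λ i → inRow A i (encode y)) (position-row-contains y) only-i₀
    where
    y = inj₂ (m , i₀)
    only-i₀ : ∀ i → T (inRow A i (encode y)) → i ≡ i₀
    only-i₀ i y∈Rᵢ with rows-containing y y∈Rᵢ
    ... | inj₁ i≡i₀         = i≡i₀
    ... | inj₂ (_ , () , _)

  rows-of-pair : ∀ s t → let n = countFin r (λ i → inRow A i (encode (inj₁ (s , t)))) in n ≡ 1 ⊎ n ≡ 2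
  rows-of-pair s t = 1≤n≤2 (countFin-≥1 (λ i → inRow A i (encode y)) (position-row-contains y))
                           (countFin-≤2 (λ i → inRow A i (encode y)) two-rows)
    where
    y = inj₁ (s , t)
    two-rows : ∀ i → T (inRow A i (encode y)) → i ≡ proj₁ (position y) ⊎ i ≡ bottom s
    two-rows i y∈Rᵢ with rows-containing y y∈Rᵢ
    ... | inj₁ i≡row                 = inj₁ i≡row
    ... | inj₂ (_ , refl , i≡bottom) = inj₂ i≡bottom

  replication-values : (Fin f → RoundOf (r * c) v 0) → RoundOf (r * c) v 1 → (Fin d → RoundOf (r * c) v 2) →
                       ∀ x → RoundOf (r * c) v (replication A x)
  replication-values 0≈rc/v 1≈rc/v 2≈rc/v x rewrite replication≡rows A (proj₁ binary) x
    with Inverse.from symbols x | Inverse.strictlyInverseˡ symbols x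
  ... | inj₂ z               | refl = subst (RoundOf (r * c) v) (sym (rows-of-padding z)) (0≈rc/v z)
  ... | inj₁ (inj₂ (m , i₀)) | refl = subst (RoundOf (r * c) v) (sym (rows-of-single m i₀)) 1≈rc/v
  ... | inj₁ (inj₁ (s , t))  | refl = [ (λ one → subst (RoundOf (r * c) v) (sym one) 1≈rc/v)
                                      , (λ two → subst (RoundOf (r * c) v) (sym two) (2≈rc/v s)) ]′ (rows-of-pair s t)

  nearTripleArray : RoundOf (r * c) v 1 → (Fin d → RoundOf (r * c) v 2) → (Fin f → RoundOf (r * c) v 0) →
                    {q : ℕ} → (∀ {i k} → i F.< k → let n = count (λ p → ⌊ p ≟² (i , k) ⌋) schedule in
                                                   n ≡ q ⊎ n ≡ suc q) →
                    NearTripleArray A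
  nearTripleArray 1≈rc/v 2≈rc/v 0≈rc/v balanced =
      binary
    , replication-values 0≈rc/v 1≈rc/v 2≈rc/v
    , roundOf-cells (rowCol A) rowCol-values
    , roundOf-orderedPairs (rowRow A) (λ i<k → subst (λ n → n ≡ _ ⊎ n ≡ _) (sym (rowRow-count i<k)) (balanced i<k))
                           (rowRow-comm A)
    , roundOf-orderedPairs (colCol A) (λ j<l → colCol-values (FP.<⇒≢ j<l)) (colCol-comm A)

module Parameters (r″ c v : ℕ) (2≤c : 2 ≤ c) (bound : 2 * (suc (suc r″) * c) ≤ 2 * v + c) where

  -- d and f are rc − v and v − rc truncated at zero, so at most one of them is nonzero.
  r′ r rc d e f : ℕ
  r′ = suc r″
  r  = suc r′
  rc = r * c
  d  = rc ∸ v
  e  = c ∸ d * 2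
  f  = v ∸ rc

  rc<2v : rc < 2 * v
  rc<2v = +-cancelʳ-< rc rc (2 * v) (begin-strict
    rc + rc      ≡⟨ cong (rc +_) (+-identityʳ rc) ⟨
    2 * rc       ≤⟨ bound ⟩
    2 * v + c    <⟨ +-monoʳ-< (2 * v) (m<m+n c (*-mono-≤ {1} {r′} (s≤s z≤n) (≤-trans (s≤s z≤n) 2≤c))) ⟩
    2 * v + rc   ∎)
    where open ≤-Reasoning

  d*2≤c : d * 2 ≤ c
  d*2≤c = begin
    (rc ∸ v) * 2   ≡⟨ *-distribʳ-∸ 2 rc v ⟩
    rc * 2 ∸ v * 2 ≤⟨ m≤n+o⇒m∸n≤o (rc * 2) (v * 2) (begin
      rc * 2         ≡⟨ *-comm rc 2 ⟩
      2 * rc         ≤⟨ bound ⟩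
      2 * v + c      ≡⟨ cong (_+ c) (*-comm 2 v) ⟩
      v * 2 + c      ∎) ⟩
    c              ∎
    where open ≤-Reasoning

  c≡d*2+e : c ≡ d * 2 + e
  c≡d*2+e = sym (m+[n∸m]≡n d*2≤c)

  v≡d*[r+r′]+e*r+f : v ≡ d * (r + r′) + e * r + f
  v≡d*[r+r′]+e*r+f = +-cancelʳ-≡ d v _ (begin
    v + d                            ≡⟨ m+[n∸m]≡n+[m∸n] v rc ⟩
    rc + f                           ≡⟨ cong (λ c → r * c + f) c≡d*2+e ⟩
    r * (d * 2 + e) + f              ≡⟨ expand r′ d e f ⟩
    d * (r + r′) + e * r + f + d     ∎)
    where
    open ≡-Reasoning
    expand : ∀ r′ d e f → suc r′ * (d * 2 + e) + f ≡ d * (suc r′ + r′) + e * suc r′ + f + d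
    expand = solve-∀

  1≈rc/v : RoundOf rc v 1
  1≈rc/v = roundOf-1 {rc} {v} (*-mono-≤ {1} {r} (s≤s z≤n) (≤-trans (s≤s z≤n) 2≤c)) rc<2v

  2≈rc/v : Fin d → RoundOf rc v 2
  2≈rc/v s = roundOf-ceil (≤-trans (≤-reflexive (cong suc (+-identityʳ v)))
                                   (m∸n≢0⇒n<m (FP.¬Fin0 ∘ λ d≡0 → subst Fin d≡0 s)))
                         (<⇒≤ rc<2v)

  0≈rc/v : Fin f → RoundOf rc v 0
  0≈rc/v z = roundOf-floor z≤n (≤-trans (m∸n≢0⇒n<m (FP.¬Fin0 ∘ λ f≡0 → subst Fin f≡0 z))
                                        (≤-reflexive (sym (+-identityʳ v))))

  pairCount : ℕ
  pairCount = r C 2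

  instance
    pairCount-nonZero : NonZero pairCount
    pairCount-nonZero = >-nonZero (subst (0 <_) (length-orderedPairs r)
                                         (∈-length (∈-orderedPairs⁺ {r} {zero} {suc zero} (s≤s z≤n))))

  schedule : List (Fin r × Fin r)
  schedule = roundRobin (orderedPairs r) (d / pairCount) (d % pairCount)

  length-schedule : length schedule ≡ d
  length-schedule = begin
    length schedule
      ≡⟨ length-roundRobin (orderedPairs r) (d / pairCount)
                           (≤-trans (m%n≤n d pairCount) (≤-reflexive (sym (length-orderedPairs r)))) ⟩
    d / pairCount * length (orderedPairs r) + d % pairCount
      ≡⟨ cong (λ n → d / pairCount * n + d % pairCount) (length-orderedPairs r) ⟩
    d / pairCount * pairCount + d % pairCount
      ≡⟨ +-comm _ (d % pairCount) ⟩
    d % pairCount + d / pairCount * pairCount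
      ≡⟨ m≡m%n+[m/n]*n d pairCount ⟨
    d ∎
    where open ≡-Reasoning

  schedule-ordered : All Ordered schedule
  schedule-ordered = All-roundRobin (orderedPairs-ordered r) (d / pairCount) (d % pairCount)

  schedule-balanced : ∀ {i k} → i F.< k → let n = count (λ p → ⌊ p ≟² (i , k) ⌋) schedule in
                      n ≡ d / pairCount ⊎ n ≡ suc (d / pairCount)
  schedule-balanced i<k =
    roundRobin-balanced _≟²_ (orderedPairs-unique r) (d / pairCount) (d % pairCount) (∈-orderedPairs⁺ i<k)

  columns≡ : c ≡ length schedule * 2 + e
  columns≡ = subst (λ n → c ≡ n * 2 + e) (sym length-schedule) c≡d*2+e

  symbols≡ : v ≡ length schedule * (r + r′) + e * r + f
  symbols≡ = subst (λ n → v ≡ n * (r + r′) + e * r + f) (sym length-schedule) v≡d*[r+r′]+e*r+f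

lemma5p5 : (r c v : ℕ) → 2 ≤ r → 2 ≤ c → 1 ≤ v → 2 * (r * c) ≤ 2 * v + c →
           Σ (Design r c v) NearTripleArray
lemma5p5 (suc (suc r″)) c v (s≤s (s≤s z≤n)) 2≤c _ bound =
  A , nearTripleArray 1≈rc/v (2≈rc/v ∘ subst Fin length-schedule) 0≈rc/v schedule-balanced
  where
  open Parameters r″ c v 2≤c bound
  open Construction r′ schedule schedule-ordered e f c v columns≡ symbols≡
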